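{- If $G$ is a maximal outerplanar graph on $n \ge 3$ vertices, then the set of vertices of degree $3$ in $G$ induces a bipartite subgraph of $G$.
   Context: A maximal outerplanar graph (MOP) is an outerplanar graph to which no edge can be added while keeping it outerplanar; equivalently, a triangulation of a polygon (all vertices on the outer face and every bounded face a triangle). -}

module Defs where

open import Data.Nat using (ℕ; zero; suc)
open import Data.Fin using (Fin; toℕ; _<_)
open import Data.Fin.Permutation using (Permutation; _⟨$⟩ʳ_)
open import Data.Bool using (Bool; true; false; if_then_else_)
open import Data.List using (map; allFin)
open import Data.Nat.ListAction using (sum)
open import Data.Product using (Σ; ∃; _×_; _,_)
open import Data.Sum using (_⊎_)
open import Relation.Binary.PropositionalEquality using (_≡_; _≢_)
open import Relation.Nullary using (¬_)

-- A finite simple graph on vertex set Fin n, given by a Bool-valued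
-- adjacency function (required symmetric and irreflexive where relevant).
Graph : ℕ → Set
Graph n = Fin n → Fin n → Bool

degree : {n : ℕ} → Graph n → Fin n → ℕ
degree {n} G v = sum (map (λ w → if G v w then 1 else 0) (allFin n))

-- Vertices of a convex polygon are the positions 0,1,...,n-1 in cyclic order.
-- i and j are consecutive on the polygon boundary (a side of the polygon).
PolygonSide : {n : ℕ} → Fin n → Fin n → Set
PolygonSide {n} i j =
  (toℕ j ≡ suc (toℕ i)) ⊎ (toℕ i ≡ suc (toℕ j)) ⊎
  ((toℕ i ≡ 0) × (suc (toℕ j) ≡ n)) ⊎ ((toℕ j ≡ 0) × (suc (toℕ i) ≡ n))

-- The chords {i,j} and {k,l} of the convex polygon cross (strictly, in
-- their interiors): their endpoints interleave in the cyclic order.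
Cross : {n : ℕ} → Fin n → Fin n → Fin n → Fin n → Set
Cross i j k l =
  (i < k × k < j × (l < i ⊎ j < l)) ⊎ (j < k × k < i × (l < j ⊎ i < l)) ⊎
  (i < l × l < j × (k < i ⊎ j < k)) ⊎ (j < l × l < i × (k < j ⊎ i < k))

record IsPolygonTriangulation {n : ℕ} (T : Graph n) : Set where
  field
    symmetric   : ∀ i j → T i j ≡ T j i
    irreflexive : ∀ i → T i i ≡ false
    sides       : ∀ i j → PolygonSide i j → T i j ≡ true
    noncrossing : ∀ i j k l → T i j ≡ true → T k l ≡ true → ¬ Cross i j k l
    maximal     : ∀ i j → i ≢ j → T i j ≡ false →
                  ∃ λ k → ∃ λ l → T k l ≡ true × Cross i j k l

-- G is a maximal outerplanar graph: G is isomorphic (via a relabelling of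
-- vertices π) to a triangulation of a convex polygon.
IsMOP : {n : ℕ} → Graph n → Set
IsMOP {n} G =
  Σ (Permutation n n) λ π →
  Σ (Graph n) λ T →
    IsPolygonTriangulation T × (∀ i j → G i j ≡ T (π ⟨$⟩ʳ i) (π ⟨$⟩ʳ j))

InducedBipartite : {n : ℕ} → Graph n → (Fin n → Set) → Set
InducedBipartite {n} G P =
  Σ (Fin n → Bool) λ c →
    ∀ u v → P u → P v → G u v ≡ true → c u ≢ c v

module Submission where

-- Draw G as a triangulated convex polygon.  A vertex of degree 3 is incident with exactly one
-- diagonal.  If two consecutive polygon vertices p, p + 1 both have degree 3, their diagonals
-- end at the apex of the triangle on the side p(p + 1), so they share that endpoint; if two
-- degree-3 vertices are joined by a diagonal, the two triangles on it force n = 4.  Hence for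
-- n ≥ 5 the degree-3 vertices only meet along polygon sides, and since not every vertex has
-- degree 3, cutting the boundary cycle at such a vertex leaves paths, which are 2-coloured by
-- the parity of the clockwise distance from the cut.  For n = 3 no vertex has degree 3 and for
-- n = 4 the two degree-3 vertices are opposite corners.

open import Defs
open import Data.Bool using (Bool; true; false; not; if_then_else_)
open import Data.Bool.Properties as Bool using (not-¬; ¬-not)
open import Data.Empty using (⊥; ⊥-elim)
open import Data.Fin using (Fin; zero; suc; toℕ; fromℕ; fromℕ<; inject₁)
open import Data.Fin.Permutation using (Permutation′; _⟨$⟩ʳ_; _⟨$⟩ˡ_; inverseˡ; inverseʳ)
open import Data.Fin.Properties using (_≟_; all?; any?; ¬∀⟶∃¬; toℕ-injective; toℕ-fromℕ; toℕ-fromℕ<; toℕ-inject₁; toℕ<n; toℕ≤pred[n])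
open import Data.List using ([]; _∷_; map; allFin; length)
open import Data.List.Membership.Propositional using (_∈_)
open import Data.List.Properties using (map-tabulate)
open import Data.List.Relation.Unary.All using (All; []; _∷_)
open import Data.List.Relation.Unary.AllPairs using ([]; _∷_)
open import Data.List.Relation.Unary.Any using (here; there)
open import Data.List.Relation.Unary.Unique.Propositional using (Unique)
open import Data.Nat as ℕ using (ℕ; _+_; _∸_; _≤_; _<_; _≥_; z≤n; s≤s; _<?_; _≤?_; _<ᵇ_)
open import Data.Nat.GeneralisedArithmetic using (fold)
open import Data.Nat.ListAction using (sum)
open import Data.Nat.Properties hiding (_≟_)
open import Algebra.Properties.CommutativeSemigroup +-commutativeSemigroup using (x∙yz≈y∙xz)
open import Data.Product using (∃₂; _×_; _,_)
open import Data.Sum as Sum using (_⊎_; inj₁; inj₂)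
open import Data.Unit using (tt)
open import Function using (id; _∘_; flip; case_of_)
open import Relation.Binary.Definitions using (tri<; tri≈; tri>)
open import Relation.Binary.PropositionalEquality
open import Relation.Nullary using (¬_; yes; no; does; ¬?)
open import Relation.Nullary.Decidable using (toWitness; _×-dec_; _⊎-dec_)
open import Relation.Unary using (Decidable)

-- Cyclic order on the polygon

Cyclic : ℕ → ℕ → ℕ → Set
Cyclic a b c = (a < b × b < c) ⊎ (b < c × c < a) ⊎ (c < a × a < b)

cyclic-rotate : ∀ {a b c} → Cyclic a b c → Cyclic b c a
cyclic-rotate (inj₁ abc) = inj₂ (inj₂ abc)
cyclic-rotate (inj₂ (inj₁ bca)) = inj₁ bca
cyclic-rotate (inj₂ (inj₂ cab)) = inj₂ (inj₁ cab)

¬cyclic-≡ˡ : ∀ {a c} → ¬ Cyclic a a c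
¬cyclic-≡ˡ (inj₁ (a<a , _)) = <-irrefl refl a<a
¬cyclic-≡ˡ (inj₂ (inj₁ (a<c , c<a))) = <-asym a<c c<a
¬cyclic-≡ˡ (inj₂ (inj₂ (_ , a<a))) = <-irrefl refl a<a

¬cyclic-≡ʳ : ∀ {a c} → ¬ Cyclic a c c
¬cyclic-≡ʳ c = ¬cyclic-≡ˡ (cyclic-rotate c)

-- b represents the successor of a in ℤ/(1 + m), both read as elements of [0, m].
data IsNext (m a b : ℕ) : Set where
  step : a < m → b ≡ ℕ.suc a → IsNext m a b
  wrap : a ≡ m → b ≡ 0 → IsNext m a b

isNext-functional : ∀ {m a b c} → IsNext m a b → IsNext m a c → b ≡ c
isNext-functional (step _ refl) (step _ refl) = refl
isNext-functional (step a<m _) (wrap refl _) = ⊥-elim (<-irrefl refl a<m)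
isNext-functional (wrap refl _) (step a<m _) = ⊥-elim (<-irrefl refl a<m)
isNext-functional (wrap _ refl) (wrap _ refl) = refl

isNext-injective : ∀ {m a b c} → IsNext m a c → IsNext m b c → a ≡ b
isNext-injective (step _ refl) (step _ e) = suc-injective e
isNext-injective (step _ refl) (wrap _ ())
isNext-injective (wrap _ refl) (step _ ())
isNext-injective (wrap refl _) (wrap refl _) = refl

private
  <-suc : ∀ {a b} → a < b → b ≢ ℕ.suc a → ℕ.suc a < b
  <-suc a<b b≢1+a = ≤∧≢⇒< a<b (b≢1+a ∘ sym)

  <-unsuc : ∀ {a b} → b < ℕ.suc a → b ≢ a → b < a
  <-unsuc b<1+a b≢a = ≤∧≢⇒< (m<1+n⇒m≤n b<1+a) b≢a

cyclic-unnextˡ : ∀ {m a a′ k b} → IsNext m a a′ → b ≤ m → Cyclic a′ k b → b ≢ a → Cyclic a k b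
cyclic-unnextˡ (step _ refl) _ (inj₁ (a′<k , k<b)) _ = inj₁ (<-trans (n<1+n _) a′<k , k<b)
cyclic-unnextˡ (step _ refl) _ (inj₂ (inj₁ (k<b , b<a′))) b≢a = inj₂ (inj₁ (k<b , <-unsuc b<a′ b≢a))
cyclic-unnextˡ (step _ refl) _ (inj₂ (inj₂ (b<a′ , a′<k))) b≢a = inj₂ (inj₂ (<-unsuc b<a′ b≢a , <-trans (n<1+n _) a′<k))
cyclic-unnextˡ (wrap refl refl) b≤m (inj₁ (_ , k<b)) b≢a = inj₂ (inj₁ (k<b , ≤∧≢⇒< b≤m b≢a))
cyclic-unnextˡ (wrap refl refl) _ (inj₂ (inj₁ (_ , ())))
cyclic-unnextˡ (wrap refl refl) _ (inj₂ (inj₂ (() , _)))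

cyclic-nextˡ : ∀ {m a a′ k b} → IsNext m a a′ → k ≤ m → Cyclic a k b → k ≢ a′ → Cyclic a′ k b
cyclic-nextˡ (step _ refl) _ (inj₁ (a<k , k<b)) k≢a′ = inj₁ (<-suc a<k k≢a′ , k<b)
cyclic-nextˡ (step _ refl) _ (inj₂ (inj₁ (k<b , b<a))) _ = inj₂ (inj₁ (k<b , <-trans b<a (n<1+n _)))
cyclic-nextˡ (step _ refl) _ (inj₂ (inj₂ (b<a , a<k))) k≢a′ = inj₂ (inj₂ (<-trans b<a (n<1+n _) , <-suc a<k k≢a′))
cyclic-nextˡ (wrap refl refl) k≤m (inj₁ (m<k , _)) _ = ⊥-elim (<-irrefl refl (<-≤-trans m<k k≤m))
cyclic-nextˡ (wrap refl refl) _ (inj₂ (inj₁ (k<b , _))) k≢0 = inj₁ (n≢0⇒n>0 k≢0 , k<b)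
cyclic-nextˡ (wrap refl refl) k≤m (inj₂ (inj₂ (_ , m<k))) _ = ⊥-elim (<-irrefl refl (<-≤-trans m<k k≤m))

¬cyclic-next : ∀ {m a a′ k} → IsNext m a a′ → k ≤ m → ¬ Cyclic a k a′
¬cyclic-next (step _ refl) _ (inj₁ (a<k , k<a′)) = <-irrefl refl (<-≤-trans k<a′ a<k)
¬cyclic-next (step _ refl) _ (inj₂ (inj₁ (_ , a′<a))) = <-asym a′<a (n<1+n _)
¬cyclic-next (step _ refl) _ (inj₂ (inj₂ (a′<a , _))) = <-asym a′<a (n<1+n _)
¬cyclic-next (wrap refl refl) _ (inj₁ (_ , ()))
¬cyclic-next (wrap refl refl) _ (inj₂ (inj₁ (() , _)))
¬cyclic-next (wrap refl refl) k≤m (inj₂ (inj₂ (_ , m<k))) = <-irrefl refl (<-≤-trans m<k k≤m)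

cyclic-next : ∀ {m a a′ z} → IsNext m a a′ → z ≤ m → z ≢ a → z ≢ a′ → Cyclic a a′ z
cyclic-next {a = a} {z = z} (step _ refl) _ z≢a z≢a′ with <-cmp z a
... | tri< z<a _ _ = inj₂ (inj₂ (z<a , n<1+n _))
... | tri≈ _ z≡a _ = ⊥-elim (z≢a z≡a)
... | tri> _ _ a<z = inj₁ (n<1+n _ , <-suc a<z z≢a′)
cyclic-next (wrap refl refl) z≤m z≢m z≢0 = inj₂ (inj₁ (n≢0⇒n>0 z≢0 , ≤∧≢⇒< z≤m z≢m))

clockwise : ℕ → ℕ → ℕ → ℕ
clockwise m a b with a ≤? b
... | yes _ = b ∸ a
... | no _ = b + ℕ.suc m ∸ a

clockwise-≤ : ∀ m {a b} → a ≤ b → clockwise m a b ≡ b ∸ a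
clockwise-≤ m {a} {b} a≤b with a ≤? b
... | yes _ = refl
... | no a≰b = ⊥-elim (a≰b a≤b)

clockwise-> : ∀ m {a b} → b < a → clockwise m a b ≡ b + ℕ.suc m ∸ a
clockwise-> m {a} {b} b<a with a ≤? b
... | yes a≤b = ⊥-elim (<-irrefl refl (<-≤-trans b<a a≤b))
... | no _ = refl

clockwise-self : ∀ m a → clockwise m a a ≡ 0
clockwise-self m a = trans (clockwise-≤ m (≤-refl {a})) (n∸n≡0 a)

clockwise-next : ∀ {m a b b′} → IsNext m b b′ → a ≤ m → b′ ≢ a →
                 clockwise m a b′ ≡ ℕ.suc (clockwise m a b)
clockwise-next {m} {a} {b} (step _ refl) a≤m b′≢a with a ≤? b
... | yes a≤b = begin
  clockwise m a (ℕ.suc b) ≡⟨ clockwise-≤ m (m≤n⇒m≤1+n a≤b) ⟩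
  ℕ.suc b ∸ a             ≡⟨ +-∸-assoc 1 a≤b ⟩
  ℕ.suc (b ∸ a)           ∎
  where open ≡-Reasoning
... | no a≰b = begin
  clockwise m a (ℕ.suc b) ≡⟨ clockwise-> m (<-suc (≰⇒> a≰b) (b′≢a ∘ sym)) ⟩
  ℕ.suc b + ℕ.suc m ∸ a   ≡⟨ +-∸-assoc 1 (≤-trans a≤m (≤-trans (n≤1+n m) (m≤n+m _ b))) ⟩
  ℕ.suc (b + ℕ.suc m ∸ a) ∎
  where open ≡-Reasoning
clockwise-next {m} {a} (wrap refl refl) a≤m 0≢a = begin
  clockwise m a 0     ≡⟨ clockwise-> m (n≢0⇒n>0 (0≢a ∘ sym)) ⟩
  ℕ.suc m ∸ a         ≡⟨ +-∸-assoc 1 a≤m ⟩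
  ℕ.suc (m ∸ a)       ≡⟨ cong ℕ.suc (clockwise-≤ m a≤m) ⟨
  ℕ.suc (clockwise m a m) ∎
  where open ≡-Reasoning

clockwise-prev : ∀ {m a b} → IsNext m b a → clockwise m a b ≡ m
clockwise-prev {m} {b = b} (step _ refl) = begin
  clockwise m (ℕ.suc b) b   ≡⟨ clockwise-> m (n<1+n b) ⟩
  b + ℕ.suc m ∸ ℕ.suc b     ≡⟨ cong (_∸ ℕ.suc b) (+-suc b m) ⟩
  b + m ∸ b                 ≡⟨ m+n∸m≡n b m ⟩
  m                         ∎
  where open ≡-Reasoning
clockwise-prev {m} (wrap refl refl) = clockwise-≤ m z≤n

parity : ℕ → Bool
parity = fold true not

module _ {m : ℕ} where

  next : Fin (ℕ.suc m) → Fin (ℕ.suc m)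
  next i with toℕ i <? m
  ... | yes i<m = fromℕ< (s≤s i<m)
  ... | no _ = zero

  prev : Fin (ℕ.suc m) → Fin (ℕ.suc m)
  prev zero = fromℕ m
  prev (suc j) = inject₁ j

  isNext-next : (i : Fin (ℕ.suc m)) → IsNext m (toℕ i) (toℕ (next i))
  isNext-next i with toℕ i <? m
  ... | yes i<m = step i<m (toℕ-fromℕ< (s≤s i<m))
  ... | no i≮m = wrap (≤-antisym (toℕ≤pred[n] i) (≮⇒≥ i≮m)) refl

  isNext-prev : (i : Fin (ℕ.suc m)) → IsNext m (toℕ (prev i)) (toℕ i)
  isNext-prev zero = wrap (toℕ-fromℕ m) refl
  isNext-prev (suc j) = step (subst (_< m) (sym (toℕ-inject₁ j)) (toℕ<n j)) (cong ℕ.suc (sym (toℕ-inject₁ j)))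

  next-prev : (i : Fin (ℕ.suc m)) → next (prev i) ≡ i
  next-prev i = toℕ-injective (isNext-functional (isNext-next (prev i)) (isNext-prev i))

  prev-next : (i : Fin (ℕ.suc m)) → prev (next i) ≡ i
  prev-next i = toℕ-injective (isNext-injective (isNext-prev (next i)) (isNext-next i))

  distance : Fin (ℕ.suc m) → Fin (ℕ.suc m) → ℕ
  distance i j = clockwise m (toℕ i) (toℕ j)

  distance-next : ∀ {i j} → next j ≢ i → distance i (next j) ≡ ℕ.suc (distance i j)
  distance-next {i} {j} nj≢i = clockwise-next (isNext-next j) (toℕ≤pred[n] i) (nj≢i ∘ toℕ-injective)

  distance-iterate : ∀ i {k} → k ≤ m → distance i (fold i next k) ≡ k
  distance-iterate i {ℕ.zero} _ = clockwise-self m (toℕ i)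
  distance-iterate i {ℕ.suc k} k<m = begin
    distance i (next j)   ≡⟨ distance-next nj≢i ⟩
    ℕ.suc (distance i j)  ≡⟨ cong ℕ.suc IH ⟩
    ℕ.suc k               ∎
    where
      open ≡-Reasoning
      j : Fin (ℕ.suc m)
      j = fold i next k
      IH : distance i j ≡ k
      IH = distance-iterate i (<⇒≤ k<m)
      nj≢i : next j ≢ i
      nj≢i nj≡i = <-irrefl (trans (sym IH) (clockwise-prev (subst (IsNext m (toℕ j) ∘ toℕ) nj≡i (isNext-next j)))) k<m

  iterate-next-toℕ : ∀ i → fold zero next (toℕ i) ≡ i
  iterate-next-toℕ i = toℕ-injective (distance-iterate zero (toℕ≤pred[n] i))

  iterate-next-≢ : ∀ i {k} → 0 < k → k ≤ m → fold i next k ≢ i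
  iterate-next-≢ i {k} 0<k k≤m eq = <⇒≢ 0<k (begin
    0                          ≡⟨ clockwise-self m (toℕ i) ⟨
    distance i i               ≡⟨ cong (distance i) eq ⟨
    distance i (fold i next k) ≡⟨ distance-iterate i k≤m ⟩
    k                          ∎)
    where open ≡-Reasoning

  prev≢next : 2 ≤ m → ∀ i → prev i ≢ next i
  prev≢next 2≤m i i′≡i″ = iterate-next-≢ (prev i) (s≤s z≤n) 2≤m (trans (cong next (next-prev i)) (sym i′≡i″))

-- The vertex j lies strictly inside the clockwise arc of the polygon from i to k.
InArc : ∀ {n} → Fin n → Fin n → Fin n → Set
InArc i j k = Cyclic (toℕ i) (toℕ j) (toℕ k)

cross⇒inArc : ∀ {n} {i j k l : Fin n} → Cross i j k l →
              (InArc i k j × InArc j l i) ⊎ (InArc i l j × InArc j k i)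
cross⇒inArc (inj₁ (i<k , k<j , inj₁ l<i)) = inj₁ (inj₁ (i<k , k<j) , inj₂ (inj₁ (l<i , <-trans i<k k<j)))
cross⇒inArc (inj₁ (i<k , k<j , inj₂ j<l)) = inj₁ (inj₁ (i<k , k<j) , inj₂ (inj₂ (<-trans i<k k<j , j<l)))
cross⇒inArc (inj₂ (inj₁ (j<k , k<i , inj₁ l<j))) = inj₂ (inj₂ (inj₁ (l<j , <-trans j<k k<i)) , inj₁ (j<k , k<i))
cross⇒inArc (inj₂ (inj₁ (j<k , k<i , inj₂ i<l))) = inj₂ (inj₂ (inj₂ (<-trans j<k k<i , i<l)) , inj₁ (j<k , k<i))
cross⇒inArc (inj₂ (inj₂ (inj₁ (i<l , l<j , inj₁ k<i)))) = inj₂ (inj₁ (i<l , l<j) , inj₂ (inj₁ (k<i , <-trans i<l l<j)))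
cross⇒inArc (inj₂ (inj₂ (inj₁ (i<l , l<j , inj₂ j<k)))) = inj₂ (inj₁ (i<l , l<j) , inj₂ (inj₂ (<-trans i<l l<j , j<k)))
cross⇒inArc (inj₂ (inj₂ (inj₂ (j<l , l<i , inj₁ k<j)))) = inj₁ (inj₂ (inj₁ (k<j , <-trans j<l l<i)) , inj₁ (j<l , l<i))
cross⇒inArc (inj₂ (inj₂ (inj₂ (j<l , l<i , inj₂ i<k)))) = inj₁ (inj₂ (inj₂ (<-trans j<l l<i , i<k)) , inj₁ (j<l , l<i))

inArc⇒cross : ∀ {n} {i j k l : Fin n} → InArc i k j → InArc j l i → Cross i j k l
inArc⇒cross (inj₁ (i<k , k<j)) (inj₁ (j<l , l<i)) = ⊥-elim (<-asym (<-trans i<k k<j) (<-trans j<l l<i))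
inArc⇒cross (inj₁ (i<k , k<j)) (inj₂ (inj₁ (l<i , _))) = inj₁ (i<k , k<j , inj₁ l<i)
inArc⇒cross (inj₁ (i<k , k<j)) (inj₂ (inj₂ (_ , j<l))) = inj₁ (i<k , k<j , inj₂ j<l)
inArc⇒cross (inj₂ (inj₁ (k<j , _))) (inj₁ (j<l , l<i)) = inj₂ (inj₂ (inj₂ (j<l , l<i , inj₁ k<j)))
inArc⇒cross (inj₂ (inj₁ (_ , j<i))) (inj₂ (inj₁ (_ , i<j))) = ⊥-elim (<-asym j<i i<j)
inArc⇒cross (inj₂ (inj₁ (_ , j<i))) (inj₂ (inj₂ (i<j , _))) = ⊥-elim (<-asym j<i i<j)
inArc⇒cross (inj₂ (inj₂ (_ , i<k))) (inj₁ (j<l , l<i)) = inj₂ (inj₂ (inj₂ (j<l , l<i , inj₂ i<k)))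
inArc⇒cross (inj₂ (inj₂ (j<i , _))) (inj₂ (inj₁ (_ , i<j))) = ⊥-elim (<-asym j<i i<j)
inArc⇒cross (inj₂ (inj₂ (j<i , _))) (inj₂ (inj₂ (i<j , _))) = ⊥-elim (<-asym j<i i<j)

module _ {m : ℕ} where

  inArc-unnextˡ : {a k b : Fin (ℕ.suc m)} → InArc (next a) k b → b ≢ a → InArc a k b
  inArc-unnextˡ {a} {b = b} c b≢a = cyclic-unnextˡ (isNext-next a) (toℕ≤pred[n] b) c (b≢a ∘ toℕ-injective)

  inArc-unnextʳ : {a k b : Fin (ℕ.suc m)} → InArc b k (next a) → k ≢ a → InArc b k a
  inArc-unnextʳ c k≢a = cyclic-rotate (inArc-unnextˡ (cyclic-rotate (cyclic-rotate c)) k≢a)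

  inArc-nextˡ : {a k b : Fin (ℕ.suc m)} → InArc a k b → k ≢ next a → InArc (next a) k b
  inArc-nextˡ {a} {k} c k≢a′ = cyclic-nextˡ (isNext-next a) (toℕ≤pred[n] k) c (k≢a′ ∘ toℕ-injective)

  inArc-nextʳ : {a k b : Fin (ℕ.suc m)} → InArc b k a → b ≢ next a → InArc b k (next a)
  inArc-nextʳ c b≢a′ = cyclic-rotate (inArc-nextˡ (cyclic-rotate (cyclic-rotate c)) b≢a′)

  ¬inArc-next : {a k : Fin (ℕ.suc m)} → ¬ InArc a k (next a)
  ¬inArc-next {a} {k} = ¬cyclic-next (isNext-next a) (toℕ≤pred[n] k)

  inArc-next : {a z : Fin (ℕ.suc m)} → z ≢ a → z ≢ next a → InArc a (next a) z
  inArc-next {a} {z} z≢a z≢a′ = cyclic-next (isNext-next a) (toℕ≤pred[n] z) (z≢a ∘ toℕ-injective) (z≢a′ ∘ toℕ-injective)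

-- Counting neighbours

indicator : Bool → ℕ
indicator b = if b then 1 else 0

count : ∀ {n} → (Fin n → Bool) → ℕ
count {n} f = sum (map (indicator ∘ f) (allFin n))

count-suc : ∀ {n} (f : Fin (ℕ.suc n) → Bool) → count f ≡ indicator (f zero) + count (f ∘ suc)
count-suc f = cong (λ xs → indicator (f zero) + sum xs)
  (trans (map-tabulate suc (indicator ∘ f)) (sym (map-tabulate id (indicator ∘ f ∘ suc))))

remove : ∀ {n} → Fin n → (Fin n → Bool) → Fin n → Bool
remove x f y = if does (y ≟ x) then false else f y

count-remove : ∀ {n} (f : Fin n → Bool) x → count f ≡ indicator (f x) + count (remove x f)
count-remove f zero = trans (count-suc f) (cong (indicator (f zero) +_) (sym (count-suc (remove zero f))))
count-remove f (suc x) = begin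
  count f                              ≡⟨ count-suc f ⟩
  a + count (f ∘ suc)                  ≡⟨ cong (a +_) (count-remove (f ∘ suc) x) ⟩
  a + (b + count (remove x (f ∘ suc))) ≡⟨ x∙yz≈y∙xz a b _ ⟩
  b + (a + count (remove x (f ∘ suc))) ≡⟨ cong (b +_) (count-suc (remove (suc x) f)) ⟨
  b + count (remove (suc x) f)         ∎
  where
    open ≡-Reasoning
    a b : ℕ
    a = indicator (f zero)
    b = indicator (f (suc x))

indicator≤1 : ∀ b → indicator b ≤ 1
indicator≤1 true = ≤-refl
indicator≤1 false = z≤n

count-false : ∀ {n} (f : Fin n → Bool) → (∀ y → f y ≡ false) → count f ≡ 0
count-false {ℕ.zero} f _ = refl
count-false {ℕ.suc n} f f≡false = begin
  count f                               ≡⟨ count-suc f ⟩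
  indicator (f zero) + count (f ∘ suc)  ≡⟨ cong₂ _+_ (cong indicator (f≡false zero)) (count-false (f ∘ suc) (f≡false ∘ suc)) ⟩
  0                                     ∎
  where open ≡-Reasoning

remove-true : ∀ {n} {x y : Fin n} f → remove x f y ≡ true → f y ≡ true × y ≢ x
remove-true {x = x} {y} f e with y ≟ x
... | no y≢x = e , y≢x

remove-≢ : ∀ {n} {x y : Fin n} f → y ≢ x → remove x f y ≡ f y
remove-≢ {x = x} {y} f y≢x with y ≟ x
... | yes y≡x = ⊥-elim (y≢x y≡x)
... | no _ = refl

count≤length : ∀ {n} (f : Fin n → Bool) xs → (∀ y → f y ≡ true → y ∈ xs) → count f ≤ length xs
count≤length f [] f⊆[] = ≤-reflexive (count-false f λ y → ¬-not (λ fy → case f⊆[] y fy of λ ()))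
count≤length f (x ∷ xs) f⊆x∷xs = begin
  count f                                ≡⟨ count-remove f x ⟩
  indicator (f x) + count (remove x f)   ≤⟨ +-mono-≤ (indicator≤1 (f x)) (count≤length (remove x f) xs f∖x⊆xs) ⟩
  1 + length xs                          ∎
  where
    open ≤-Reasoning
    f∖x⊆xs : ∀ y → remove x f y ≡ true → y ∈ xs
    f∖x⊆xs y e with remove-true f e
    ... | fy , y≢x with f⊆x∷xs y fy
    ...   | here y≡x = ⊥-elim (y≢x y≡x)
    ...   | there y∈xs = y∈xs

length≤count : ∀ {n} (f : Fin n → Bool) xs → Unique xs → All (λ y → f y ≡ true) xs → length xs ≤ count f
length≤count f [] _ _ = z≤n
length≤count f (x ∷ xs) (x∉xs ∷ xs-unique) (fx ∷ fxs) = begin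
  1 + length xs                          ≤⟨ +-mono-≤ (≤-reflexive (cong indicator (sym fx)))
                                                     (length≤count (remove x f) xs xs-unique (remove-all x∉xs fxs)) ⟩
  indicator (f x) + count (remove x f)   ≡⟨ count-remove f x ⟨
  count f                                ∎
  where
    open ≤-Reasoning
    remove-all : ∀ {ys} → All (x ≢_) ys → All (λ y → f y ≡ true) ys → All (λ y → remove x f y ≡ true) ys
    remove-all [] [] = []
    remove-all (x≢y ∷ x≢ys) (fy ∷ fys) = trans (remove-≢ f (x≢y ∘ sym)) fy ∷ remove-all x≢ys fys

record ThirdNeighbour {n} (G : Graph n) (v x₁ x₂ : Fin n) : Set where
  field
    third      : Fin n
    adjacent   : G v third ≡ true
    third≢₁    : third ≢ x₁
    third≢₂    : third ≢ x₂
    neighbours : ∀ y → G v y ≡ true → y ≡ x₁ ⊎ y ≡ x₂ ⊎ y ≡ third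

degree-3⇒thirdNeighbour : ∀ {n} (G : Graph n) {v x₁ x₂} → x₁ ≢ x₂ → G v x₁ ≡ true → G v x₂ ≡ true →
  degree G v ≡ 3 → ThirdNeighbour G v x₁ x₂
degree-3⇒thirdNeighbour G {v} {x₁} {x₂} x₁≢x₂ gx₁ gx₂ deg≡3
  with any? (λ z → (G v z Bool.≟ true) ×-dec ¬? (z ≟ x₁) ×-dec ¬? (z ≟ x₂))
... | no none = ⊥-elim (3≰2 (subst (_≤ 2) deg≡3 (count≤length (G v) (x₁ ∷ x₂ ∷ []) only-x₁x₂)))
  where
    3≰2 : ¬ 3 ≤ 2
    3≰2 (s≤s (s≤s ()))
    only-x₁x₂ : ∀ y → G v y ≡ true → y ∈ x₁ ∷ x₂ ∷ []
    only-x₁x₂ y gy with y ≟ x₁ | y ≟ x₂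
    ... | yes y≡x₁ | _ = here y≡x₁
    ... | no _ | yes y≡x₂ = there (here y≡x₂)
    ... | no y≢x₁ | no y≢x₂ = ⊥-elim (none (y , gy , y≢x₁ , y≢x₂))
... | yes (z , gz , z≢x₁ , z≢x₂) =
  record { third = z ; adjacent = gz ; third≢₁ = z≢x₁ ; third≢₂ = z≢x₂ ; neighbours = only-x₁x₂z }
  where
    4≰3 : ¬ 4 ≤ 3
    4≰3 (s≤s (s≤s (s≤s ())))
    only-x₁x₂z : ∀ y → G v y ≡ true → y ≡ x₁ ⊎ y ≡ x₂ ⊎ y ≡ z
    only-x₁x₂z y gy with y ≟ x₁ | y ≟ x₂ | y ≟ z
    ... | yes y≡x₁ | _ | _ = inj₁ y≡x₁
    ... | no _ | yes y≡x₂ | _ = inj₂ (inj₁ y≡x₂)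
    ... | no _ | no _ | yes y≡z = inj₂ (inj₂ y≡z)
    ... | no y≢x₁ | no y≢x₂ | no y≢z = ⊥-elim (4≰3 (subst (4 ≤_) deg≡3
            (length≤count (G v) (y ∷ z ∷ x₁ ∷ x₂ ∷ [])
              ((y≢z ∷ y≢x₁ ∷ y≢x₂ ∷ []) ∷ (z≢x₁ ∷ z≢x₂ ∷ []) ∷ (x₁≢x₂ ∷ []) ∷ [] ∷ [])
              (gy ∷ gz ∷ gx₁ ∷ gx₂ ∷ []))))

-- Triangulated polygons

module Polygon {m : ℕ} (T : Graph (ℕ.suc m)) (tri : IsPolygonTriangulation T) where

  open IsPolygonTriangulation tri

  edge⇒≢ : ∀ {a b} → T a b ≡ true → a ≢ b
  edge⇒≢ {a} e refl with trans (sym e) (irreflexive a)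
  ... | ()

  side-next : ∀ a → T a (next a) ≡ true
  side-next a = sides a (next a) (side (isNext-next a))
    where
      side : IsNext m (toℕ a) (toℕ (next a)) → PolygonSide a (next a)
      side (step _ e) = inj₁ e
      side (wrap a≡m e) = inj₂ (inj₂ (inj₂ (e , cong ℕ.suc a≡m)))

  side-prev : ∀ a → T a (prev a) ≡ true
  side-prev a = trans (symmetric a (prev a)) (subst (λ z → T (prev a) z ≡ true) (next-prev a) (side-next (prev a)))

  next≢ : ∀ a → next a ≢ a
  next≢ a = edge⇒≢ (side-next a) ∘ sym

  edge-or-crossed : ∀ i j → i ≢ j → T i j ≡ true ⊎ ∃₂ λ k l → T k l ≡ true × InArc i k j × InArc j l i
  edge-or-crossed i j i≢j with T i j in e
  ... | true = inj₁ refl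
  ... | false with maximal i j i≢j e
  ...   | k , l , tkl , cross with cross⇒inArc cross
  ...     | inj₁ (ikj , jli) = inj₂ (k , l , tkl , ikj , jli)
  ...     | inj₂ (ilj , jki) = inj₂ (l , k , trans (symmetric l k) tkl , ilj , jki)

  ¬crossing : ∀ {i j k l} → T i j ≡ true → T k l ≡ true → InArc i k j → InArc j l i → ⊥
  ¬crossing {i} {j} {k} {l} tij tkl ikj jli = noncrossing i j k l tij tkl (inArc⇒cross ikj jli)

  -- An edge crossing the chord (a + 1, b) either leaves a into the arc (a + 1, b) or also crosses (a, b).
  first-neighbour-adjacent-next : ∀ {a b} → T a b ≡ true → b ≢ a → b ≢ next a →
    (∀ y → T a y ≡ true → ¬ InArc (next a) y b) → T (next a) b ≡ true
  first-neighbour-adjacent-next {a} {b} tab b≢a b≢a′ first with edge-or-crossed (next a) b (b≢a′ ∘ sym)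
  ... | inj₁ ta′b = ta′b
  ... | inj₂ (k , l , tkl , a′kb , bla′) with l ≟ a
  ...   | yes refl = ⊥-elim (first k (trans (symmetric l k) tkl) a′kb)
  ...   | no l≢a = ⊥-elim (¬crossing tab tkl (inArc-unnextˡ a′kb b≢a) (inArc-unnextʳ bla′ l≢a))

  last-neighbour-adjacent-prev : ∀ {a b} → T (next a) b ≡ true → b ≢ a → b ≢ next a →
    (∀ y → T (next a) y ≡ true → ¬ InArc b y a) → T a b ≡ true
  last-neighbour-adjacent-prev {a} {b} ta′b b≢a b≢a′ last with edge-or-crossed a b (b≢a ∘ sym)
  ... | inj₁ tab = tab
  ... | inj₂ (k , l , tkl , akb , bla) with k ≟ next a
  ...   | yes refl = ⊥-elim (last l tkl bla)
  ...   | no k≢a′ = ⊥-elim (¬crossing ta′b tkl (inArc-nextˡ akb k≢a′) (inArc-nextʳ bla b≢a′))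

  OneDiagonal : Fin (ℕ.suc m) → Set
  OneDiagonal p = ThirdNeighbour T p (prev p) (next p)

  open ThirdNeighbour

  third≢ : ∀ {p} (D : OneDiagonal p) → third D ≢ p
  third≢ D = edge⇒≢ (adjacent D) ∘ sym

  third-adjacent-next : ∀ {p} (D : OneDiagonal p) → T (next p) (third D) ≡ true
  third-adjacent-next {p} D = first-neighbour-adjacent-next (adjacent D) (third≢ D) (third≢₂ D) first
    where
      first : ∀ y → T p y ≡ true → ¬ InArc (next p) y (third D)
      first y tpy a′yd with neighbours D y tpy
      ... | inj₁ refl = ¬inArc-next (subst (InArc (prev p) (third D)) (sym (next-prev p))
                                       (inArc-unnextʳ (cyclic-rotate a′yd) (third≢ D)))
      ... | inj₂ (inj₁ refl) = ¬cyclic-≡ˡ a′yd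
      ... | inj₂ (inj₂ refl) = ¬cyclic-≡ʳ a′yd

  third-adjacent-prev : ∀ {a} (D : OneDiagonal (next a)) → T a (third D) ≡ true
  third-adjacent-prev {a} D = last-neighbour-adjacent-prev (adjacent D) third≢a (third≢ D) last
    where
      third≢a : third D ≢ a
      third≢a e = third≢₁ D (trans e (sym (prev-next a)))
      last : ∀ y → T (next a) y ≡ true → ¬ InArc (third D) y a
      last y ta′y dya with neighbours D y ta′y
      ... | inj₁ refl = ¬cyclic-≡ʳ (subst (λ z → InArc (third D) z a) (prev-next a) dya)
      ... | inj₂ (inj₁ refl) = ¬inArc-next (cyclic-rotate (inArc-unnextˡ (cyclic-rotate dya) (third≢ D)))
      ... | inj₂ (inj₂ refl) = ¬cyclic-≡ˡ dya

  consecutive-same-third : ∀ {p} (Dp : OneDiagonal p) (Dp′ : OneDiagonal (next p)) → third Dp ≡ third Dp′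
  consecutive-same-third {p} Dp Dp′ with neighbours Dp (third Dp′) (third-adjacent-prev Dp′)
  ... | inj₁ d′≡prev = ⊥-elim (¬crossing (adjacent Dp) (adjacent Dp′) (inArc-next (third≢ Dp) (third≢₂ Dp)) prev-inArc)
    where
      -- the chord (p + 1, p − 1) would cross the diagonal at p
      prev-inArc : InArc (third Dp) (third Dp′) p
      prev-inArc = subst₂ (InArc (third Dp)) (sym d′≡prev) (next-prev p)
                 (cyclic-rotate (cyclic-rotate (inArc-next (third≢₁ Dp) (third≢ Dp ∘ flip trans (next-prev p)))))
  ... | inj₂ (inj₁ d′≡next) = ⊥-elim (third≢ Dp′ d′≡next)
  ... | inj₂ (inj₂ d′≡d) = sym d′≡d

  third-sym : ∀ {p q} (Dp : OneDiagonal p) (Dq : OneDiagonal q) → third Dp ≡ q → third Dq ≡ p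
  third-sym {p} {q} Dp Dq refl with neighbours Dq p (trans (symmetric q p) (adjacent Dp))
  ... | inj₁ p≡prev = ⊥-elim (third≢₂ Dp (trans (sym (next-prev q)) (cong next (sym p≡prev))))
  ... | inj₂ (inj₁ p≡next) = ⊥-elim (third≢₁ Dp (trans (sym (prev-next q)) (cong prev (sym p≡next))))
  ... | inj₂ (inj₂ p≡third) = sym p≡third

  next-next-third : ∀ {p q} (Dp : OneDiagonal p) (Dq : OneDiagonal q) → third Dp ≡ q → next (next p) ≡ q
  next-next-third {p} {q} Dp Dq refl with neighbours Dq (next p) (trans (symmetric q (next p)) (third-adjacent-next Dp))
  ... | inj₁ p′≡prev = trans (cong next p′≡prev) (next-prev q)
  ... | inj₂ (inj₁ p′≡next) = ⊥-elim (third≢ Dp (sym (trans (sym (prev-next p)) (trans (cong prev p′≡next) (prev-next q)))))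
  ... | inj₂ (inj₂ p′≡third) = ⊥-elim (next≢ p (trans p′≡third (third-sym Dp Dq refl)))

  diagonal⇒quadrilateral : ∀ {p q} (Dp : OneDiagonal p) (Dq : OneDiagonal q) → third Dp ≡ q → fold p next 4 ≡ p
  diagonal⇒quadrilateral Dp Dq d≡q =
    trans (cong (next ∘ next) (next-next-third Dp Dq d≡q)) (next-next-third Dq Dp (third-sym Dp Dq d≡q))

  ¬all-oneDiagonal : ¬ (∀ p → OneDiagonal p)
  ¬all-oneDiagonal D = third≢ (D w) (trans (cong (third ∘ D) (sym (iterate-next-toℕ w))) (constant (toℕ w)))
    where
      constant : ∀ k → third (D (fold zero next k)) ≡ third (D zero)
      constant ℕ.zero = refl
      constant (ℕ.suc k) = trans (sym (consecutive-same-third (D _) (D _))) (constant k)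
      w : Fin (ℕ.suc m)
      w = third (D zero)

  oneDiagonal-edge⇒side : 4 ≤ m → ∀ {p q} → OneDiagonal p → OneDiagonal q → T p q ≡ true → q ≡ next p ⊎ p ≡ next q
  oneDiagonal-edge⇒side 4≤m {p} Dp Dq tpq with neighbours Dp _ tpq
  ... | inj₁ q≡prev = inj₂ (trans (sym (next-prev p)) (cong next (sym q≡prev)))
  ... | inj₂ (inj₁ q≡next) = inj₁ q≡next
  ... | inj₂ (inj₂ q≡third) = ⊥-elim (iterate-next-≢ p (s≤s z≤n) 4≤m (diagonal⇒quadrilateral Dp Dq (sym q≡third)))

  bipartite-large : 4 ≤ m → ∀ {P} → Decidable P → (∀ p → P p → OneDiagonal p) → InducedBipartite T P
  bipartite-large 4≤m {P} P? one with ¬∀⟶∃¬ _ P P? (λ all → ¬all-oneDiagonal (λ p → one p (all p)))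
  ... | e , ¬Pe = colour , proper
    where
      colour : Fin (ℕ.suc m) → Bool
      colour p = parity (distance e p)

      colour-next : ∀ {p} → P (next p) → colour p ≢ colour (next p)
      colour-next {p} Pp′ c≡c′ =
        not-¬ refl (trans c≡c′ (cong parity (distance-next (λ p′≡e → ¬Pe (subst P p′≡e Pp′)))))

      proper : ∀ p q → P p → P q → T p q ≡ true → colour p ≢ colour q
      proper p q Pp Pq tpq with oneDiagonal-edge⇒side 4≤m (one p Pp) (one q Pq) tpq
      ... | inj₁ refl = colour-next Pq
      ... | inj₂ refl = colour-next Pp ∘ sym

-- Triangles and quadrilaterals

triangle-cover : ∀ (p d : Fin 3) → d ≡ p ⊎ d ≡ prev p ⊎ d ≡ next p
triangle-cover = toWitness {a? = all? λ p → all? λ d → (d ≟ p) ⊎-dec (d ≟ prev p) ⊎-dec (d ≟ next p)} tt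

quadrilateral-cover : ∀ (p d : Fin 4) → d ≡ p ⊎ d ≡ prev p ⊎ d ≡ next p ⊎ d ≡ next (next p)
quadrilateral-cover = toWitness {a? = all? λ p → all? λ d →
  (d ≟ p) ⊎-dec (d ≟ prev p) ⊎-dec (d ≟ next p) ⊎-dec (d ≟ next (next p))} tt

half : Fin 4 → Bool
half p = toℕ p <ᵇ 2

half-opposite : ∀ p → half p ≢ half (next (next p))
half-opposite = toWitness {a? = all? λ p → ¬? (half p Bool.≟ half (next (next p)))} tt

module _ (T : Graph 3) (tri : IsPolygonTriangulation T) where

  open Polygon T tri
  open ThirdNeighbour

  ¬oneDiagonal-triangle : ∀ {p} → ¬ OneDiagonal p
  ¬oneDiagonal-triangle {p} D with triangle-cover p (third D)
  ... | inj₁ d≡p = third≢ D d≡p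
  ... | inj₂ (inj₁ d≡prev) = third≢₁ D d≡prev
  ... | inj₂ (inj₂ d≡next) = third≢₂ D d≡next

module _ (T : Graph 4) (tri : IsPolygonTriangulation T) where

  open Polygon T tri
  open ThirdNeighbour

  third-opposite : ∀ {p} (D : OneDiagonal p) → third D ≡ next (next p)
  third-opposite {p} D with quadrilateral-cover p (third D)
  ... | inj₁ d≡p = ⊥-elim (third≢ D d≡p)
  ... | inj₂ (inj₁ d≡prev) = ⊥-elim (third≢₁ D d≡prev)
  ... | inj₂ (inj₂ (inj₁ d≡next)) = ⊥-elim (third≢₂ D d≡next)
  ... | inj₂ (inj₂ (inj₂ d≡opposite)) = d≡opposite

  ¬consecutive-oneDiagonal : ∀ {p} → OneDiagonal p → ¬ OneDiagonal (next p)
  ¬consecutive-oneDiagonal {p} Dp Dp′ = next≢ (next (next p))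
    (sym (trans (sym (third-opposite Dp)) (trans (consecutive-same-third Dp Dp′) (third-opposite Dp′))))

  bipartite-quadrilateral : ∀ {P} → (∀ p → P p → OneDiagonal p) → InducedBipartite T P
  bipartite-quadrilateral {P} one = half , proper
    where
      proper : ∀ p q → P p → P q → T p q ≡ true → half p ≢ half q
      proper p q Pp Pq tpq with neighbours (one p Pp) q tpq
      ... | inj₁ refl = ⊥-elim (¬consecutive-oneDiagonal (one q Pq) (subst OneDiagonal (sym (next-prev p)) (one p Pp)))
      ... | inj₂ (inj₁ refl) = ⊥-elim (¬consecutive-oneDiagonal (one p Pp) (one q Pq))
      ... | inj₂ (inj₂ refl) = subst (λ z → half p ≢ half z) (sym (third-opposite (one p Pp))) (half-opposite p)

oneDiagonal-bipartite : ∀ {m} → 2 ≤ m → (T : Graph (ℕ.suc m)) (tri : IsPolygonTriangulation T) →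
  ∀ {P} → Decidable P → (∀ p → P p → Polygon.OneDiagonal T tri p) → InducedBipartite T P
oneDiagonal-bipartite {1} (s≤s ())
oneDiagonal-bipartite {2} _ T tri _ one = (λ _ → true) , λ p _ Pp _ _ → ⊥-elim (¬oneDiagonal-triangle T tri (one p Pp))
oneDiagonal-bipartite {3} _ T tri _ one = bipartite-quadrilateral T tri one
oneDiagonal-bipartite {ℕ.suc (ℕ.suc (ℕ.suc (ℕ.suc _)))} _ T tri P? one =
  Polygon.bipartite-large T tri (s≤s (s≤s (s≤s (s≤s z≤n)))) P? one

module Relabel {n} {G T : Graph n} (π : Permutation′ n) (G≡T : ∀ i j → G i j ≡ T (π ⟨$⟩ʳ i) (π ⟨$⟩ʳ j)) where

  G≡T⁻¹ : ∀ a b → G (π ⟨$⟩ˡ a) (π ⟨$⟩ˡ b) ≡ T a b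
  G≡T⁻¹ a b = trans (G≡T _ _) (cong₂ T (inverseʳ π) (inverseʳ π))

  ⟨$⟩ˡ-injective : ∀ {a b} → π ⟨$⟩ˡ a ≡ π ⟨$⟩ˡ b → a ≡ b
  ⟨$⟩ˡ-injective {a} {b} e = trans (sym (inverseʳ π)) (trans (cong (π ⟨$⟩ʳ_) e) (inverseʳ π))

  thirdNeighbour-transport : ∀ {v a b} → ThirdNeighbour G (π ⟨$⟩ˡ v) (π ⟨$⟩ˡ a) (π ⟨$⟩ˡ b) → ThirdNeighbour T v a b
  thirdNeighbour-transport {v} {a} {b} D = record
    { third      = π ⟨$⟩ʳ z
    ; adjacent   = trans (sym (G≡T⁻¹ v (π ⟨$⟩ʳ z))) (trans (cong (G (π ⟨$⟩ˡ v)) (inverseˡ π)) (adjacent D))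
    ; third≢₁    = third≢₁ D ∘ moved
    ; third≢₂    = third≢₂ D ∘ moved
    ; neighbours = λ y tvy →
        Sum.map ⟨$⟩ˡ-injective (Sum.map ⟨$⟩ˡ-injective λ e → ⟨$⟩ˡ-injective (trans e (sym (inverseˡ π))))
                (neighbours D (π ⟨$⟩ˡ y) (trans (G≡T⁻¹ v y) tvy))
    }
    where
      open ThirdNeighbour
      z : Fin n
      z = third D
      moved : ∀ {x} → π ⟨$⟩ʳ z ≡ x → z ≡ π ⟨$⟩ˡ x
      moved e = trans (sym (inverseˡ π)) (cong (π ⟨$⟩ˡ_) e)

  bipartite-transport : ∀ {P Q : Fin n → Set} → (∀ v → Q v → P (π ⟨$⟩ʳ v)) → InducedBipartite T P → InducedBipartite G Q
  bipartite-transport Q⇒P (c , proper) =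
    c ∘ (π ⟨$⟩ʳ_) , λ u v Qu Qv guv → proper _ _ (Q⇒P u Qu) (Q⇒P v Qv) (trans (sym (G≡T u v)) guv)

lemma1 : (n : ℕ) → n ≥ 3 → (G : Graph n) → IsMOP G →
         InducedBipartite G (λ v → degree G v ≡ 3)
lemma1 (ℕ.suc m) (s≤s 2≤m) G (π , T , tri , G≡T) =
  bipartite-transport (λ v → subst (λ u → degree G u ≡ 3) (sym (inverseˡ π)))
    (oneDiagonal-bipartite 2≤m T tri (λ p → degree G (π ⟨$⟩ˡ p) ℕ.≟ 3) oneDiagonal)
  where
    open Relabel {T = T} π G≡T
    open Polygon T tri
    oneDiagonal : ∀ p → degree G (π ⟨$⟩ˡ p) ≡ 3 → OneDiagonal p
    oneDiagonal p deg≡3 = thirdNeighbour-transport (degree-3⇒thirdNeighbour G (prev≢next 2≤m p ∘ ⟨$⟩ˡ-injective)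
      (trans (G≡T⁻¹ p (prev p)) (side-prev p)) (trans (G≡T⁻¹ p (next p)) (side-next p)) deg≡3)
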